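{- Let $a,b>2$ be integers and let $G_{a,b}$ be the grid graph with vertex set $\{1,\dots,a\}\times\{1,\dots,b\}$ ($n=ab$ vertices). For an ordering $s: u_1,\dots,u_n$ of all vertices of $G_{a,b}$, where $u_i=(x_i,y_i)$, let $d_x(s)=\sum_{i=1}^{n-1}|x_{i+1}-x_i|$. Then the maximum of $d_x(s)$ over all such orderings $s$ equals $$ \max_s d_x(s) = \begin{cases} \dfrac{a^2b}{2}-1, & \text{if } a \text{ is even},\\[1em] \dfrac{(a^2-1)b}{2}, & \text{if } a \text{ is odd}. \end{cases} $$
   Context: An ordering of the vertices means a sequence listing each vertex of $G_{a,b}$ exactly once. $d_x(s)$ is the sum of the $x$-components of the distances between consecutive vertices in the ordering. -}

module Defs where

open import Data.Nat using (ℕ; zero; suc; _+_; _*_; _∸_; _≤_)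
open import Data.Nat.DivMod using (_/_; _%_)
open import Data.Fin using (Fin; toℕ)
open import Data.Product using (_×_; _,_; proj₁; Σ)
open import Data.List using (List; []; _∷_; map; concatMap)
open import Data.List.Relation.Binary.Permutation.Propositional using (_↭_)
open import Data.List using (allFin)

-- Vertices of the grid graph G_{a,b}: coordinates (x , y) with x ∈ {1..a}, y ∈ {1..b},
-- represented 0-based as Fin a × Fin b (shifting does not change differences).
Vertex : ℕ → ℕ → Set
Vertex a b = Fin a × Fin b

allVertices : (a b : ℕ) → List (Vertex a b)
allVertices a b = concatMap (λ x → map (λ y → (x , y)) (allFin b)) (allFin a)

Ordering : ℕ → ℕ → Set
Ordering a b = Σ (List (Vertex a b)) (λ s → s ↭ allVertices a b)

absDiff : ℕ → ℕ → ℕ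
absDiff m n = (m ∸ n) + (n ∸ m)

dxList : {a b : ℕ} → List (Vertex a b) → ℕ
dxList [] = 0
dxList (u ∷ []) = 0
dxList (u ∷ v ∷ s) = absDiff (toℕ (proj₁ u)) (toℕ (proj₁ v)) + dxList (v ∷ s)

dx : {a b : ℕ} → Ordering a b → ℕ
dx (s , _) = dxList s

-- The claimed maximum value:
--   a even : a²b/2 − 1
--   a odd  : (a² − 1)b/2
-- (both divisions are exact in the respective cases).
maxDx : ℕ → ℕ → ℕ
maxDx a b with a % 2
... | 0 = (a * a * b) / 2 ∸ 1
... | _ = ((a * a ∸ 1) * b) / 2

module Submission where

-- Measure x-coordinates on a doubled axis, X = 2x + 1, so that the central
-- vertical line of the grid sits at X = a, and let dev a x = |2x + 1 - a| be
-- the (doubled) deviation of column x from it.  For any sequence of numbers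
-- and any centre c, every step |X - Y| is at most |X - c| + |c - Y|; summing
-- along the sequence gives
--     variation + |first - c| + |last - c|  ≤  2 · Σ |X_i - c| ,
-- with equality when consecutive terms lie on opposite sides of c.  For an
-- ordering s of the grid this reads 2 dx(s) + dev(first) + dev(last) ≤ 2bD(a)
-- where D(a) = Σ_{x<a} dev a x, a closed form computed by induction.
-- If a is odd every deviation is ≥ 0, giving dx ≤ bD(a); if a is even every
-- deviation is odd, hence ≥ 1, giving dx ≤ bD(a) - 1.  Both bounds are
-- attained by a zig-zag ordering that alternates between the left and right
-- halves of the grid and starts and ends in a central column.

open import Defs
open import Data.Nat using (ℕ; _≤_; _>_)
open import Data.Product using (_×_; Σ)
open import Relation.Binary.PropositionalEquality using (_≡_)

open import Data.Nat using (zero; suc; _+_; _*_; _∸_; ∣_-_∣; z≤n; s≤s; _<_)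
open import Data.Nat.Properties
open import Data.Nat.DivMod using (_/_; _%_; [m+kn]%n≡m%n; m*n/n≡m)
open import Data.Nat.Tactic.RingSolver using (solve-∀)
open import Data.Nat.ListAction using (sum)
open import Data.Nat.ListAction.Properties using (sum-↭; sum-++)
open import Data.Product using (_,_; proj₁; ∃-syntax)
open import Data.Sum using (_⊎_; inj₁; inj₂)
open import Data.Unit using (⊤; tt)
open import Data.List using (List; []; _∷_; _++_; map; length; concatMap; tabulate; allFin)
open import Data.List.Properties using (map-++; map-∘; map-tabulate; length-tabulate; length-map; length-++; concatMap-++)
open import Data.List.Relation.Binary.Permutation.Propositional using (_↭_; ↭-refl; ↭-sym; ↭-trans; ↭-reflexive; prep)
import Data.List.Relation.Binary.Permutation.Propositional.Properties as ↭
import Algebra.Solver.CommutativeMonoid as CommutativeMonoidSolver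
open import Data.Vec using ([]; _∷_)
open import Data.Fin using (Fin; toℕ; _↑ˡ_; _↑ʳ_; #_)
open import Data.Fin.Properties using (toℕ-↑ˡ; toℕ-↑ʳ; toℕ<n)
open import Function using (_∘_)
open import Data.List.Relation.Unary.All as All using (All; []; _∷_)
import Data.List.Relation.Unary.All.Properties as All
open import Relation.Binary.PropositionalEquality using (refl; sym; trans; cong; cong₂; subst; module ≡-Reasoning)

private
  variable
    A B : Set

-- Sequences of natural numbers

variation : List ℕ → ℕ
variation []          = 0
variation (x ∷ [])    = 0
variation (x ∷ y ∷ s) = ∣ x - y ∣ + variation (y ∷ s)

final : A → List A → A
final x []       = x
final x (y ∷ ys) = final y ys

final-map : (f : A → B) (x : A) (xs : List A) → final (f x) (map f xs) ≡ f (final x xs)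
final-map f x []       = refl
final-map f x (y ∷ ys) = final-map f y ys

final-++ : (p : A) (xs : List A) (y : A) (ys : List A) → final p (xs ++ y ∷ ys) ≡ final y ys
final-++ p []       y ys = refl
final-++ p (x ∷ xs) y ys = final-++ x xs y ys

spread : ℕ → List ℕ → ℕ
spread c xs = sum (map (λ x → ∣ x - c ∣) xs)

Straddle : ℕ → ℕ → ℕ → Set
Straddle c x y = (x ≤ c × c ≤ y) ⊎ (c ≤ x × y ≤ c)

Alternates : ℕ → List ℕ → Set
Alternates c []          = ⊤
Alternates c (x ∷ [])    = ⊤
Alternates c (x ∷ y ∷ s) = Straddle c x y × Alternates c (y ∷ s)

step-bound : ∀ c x y → ∣ x - y ∣ ≤ ∣ x - c ∣ + ∣ y - c ∣
step-bound c x y = subst (∣ x - y ∣ ≤_) (cong (∣ x - c ∣ +_) (∣-∣-comm c y)) (∣-∣-triangle x c y)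

step-exact : ∀ c x y → Straddle c x y → ∣ x - y ∣ ≡ ∣ x - c ∣ + ∣ y - c ∣
step-exact c x y (inj₁ (x≤c , c≤y)) = begin
  ∣ x - y ∣             ≡⟨ m≤n⇒∣m-n∣≡n∸m (≤-trans x≤c c≤y) ⟩
  y ∸ x                 ≡⟨ cong (_∸ x) (sym (m∸n+n≡m c≤y)) ⟩
  (y ∸ c) + c ∸ x       ≡⟨ +-∸-assoc (y ∸ c) x≤c ⟩
  (y ∸ c) + (c ∸ x)     ≡⟨ +-comm (y ∸ c) (c ∸ x) ⟩
  (c ∸ x) + (y ∸ c)     ≡⟨ sym (cong₂ _+_ (m≤n⇒∣m-n∣≡n∸m x≤c) (m≤n⇒∣n-m∣≡n∸m c≤y)) ⟩
  ∣ x - c ∣ + ∣ y - c ∣ ∎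
  where open ≡-Reasoning
step-exact c x y (inj₂ (c≤x , y≤c)) = begin
  ∣ x - y ∣             ≡⟨ ∣-∣-comm x y ⟩
  ∣ y - x ∣             ≡⟨ step-exact c y x (inj₁ (y≤c , c≤x)) ⟩
  ∣ y - c ∣ + ∣ x - c ∣ ≡⟨ +-comm ∣ y - c ∣ ∣ x - c ∣ ⟩
  ∣ x - c ∣ + ∣ y - c ∣ ∎
  where open ≡-Reasoning

private
  prepend-lhs : ∀ p d fx fy fl → fy + (p + d + fx + fl) ≡ p + (d + fy + fl) + fx
  prepend-lhs = solve-∀

  prepend-rhs : ∀ fx fy S → fx + fy + 2 * S + fx ≡ fy + 2 * (fx + S)
  prepend-rhs = solve-∀

  singleton : ∀ f → 0 + f + f ≡ 2 * (f + 0)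
  singleton = solve-∀

variation-bound : ∀ c x xs →
  variation (x ∷ xs) + ∣ x - c ∣ + ∣ final x xs - c ∣ ≤ 2 * spread c (x ∷ xs)
variation-bound c x []      = ≤-reflexive (singleton ∣ x - c ∣)
variation-bound c x (y ∷ s) = +-cancelˡ-≤ fy _ _ (begin
  fy + (∣ x - y ∣ + variation (y ∷ s) + fx + fl) ≡⟨ prepend-lhs ∣ x - y ∣ _ fx fy fl ⟩
  ∣ x - y ∣ + (variation (y ∷ s) + fy + fl) + fx
    ≤⟨ +-monoˡ-≤ fx (+-mono-≤ (step-bound c x y) (variation-bound c y s)) ⟩
  fx + fy + 2 * spread c (y ∷ s) + fx            ≡⟨ prepend-rhs fx fy _ ⟩
  fy + 2 * spread c (x ∷ y ∷ s)                  ∎)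
  where
  open ≤-Reasoning
  fx = ∣ x - c ∣
  fy = ∣ y - c ∣
  fl = ∣ final y s - c ∣

variation-exact : ∀ c x xs → Alternates c (x ∷ xs) →
  variation (x ∷ xs) + ∣ x - c ∣ + ∣ final x xs - c ∣ ≡ 2 * spread c (x ∷ xs)
variation-exact c x []      _            = singleton ∣ x - c ∣
variation-exact c x (y ∷ s) (xy , rest) = +-cancelˡ-≡ fy _ _ (begin
  fy + (∣ x - y ∣ + variation (y ∷ s) + fx + fl) ≡⟨ prepend-lhs ∣ x - y ∣ _ fx fy fl ⟩
  ∣ x - y ∣ + (variation (y ∷ s) + fy + fl) + fx
    ≡⟨ cong (_+ fx) (cong₂ _+_ (step-exact c x y xy) (variation-exact c y s rest)) ⟩
  fx + fy + 2 * spread c (y ∷ s) + fx            ≡⟨ prepend-rhs fx fy _ ⟩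
  fy + 2 * spread c (x ∷ y ∷ s)                  ∎)
  where
  open ≡-Reasoning
  fx = ∣ x - c ∣
  fy = ∣ y - c ∣
  fl = ∣ final y s - c ∣

-- Deviation of a column from the centre of the grid

sumBelow : ℕ → (ℕ → ℕ) → ℕ
sumBelow zero    f = 0
sumBelow (suc n) f = f 0 + sumBelow n (λ i → f (suc i))

sumBelow-cong : ∀ n {f g : ℕ → ℕ} → (∀ i → f i ≡ g i) → sumBelow n f ≡ sumBelow n g
sumBelow-cong zero    f≗g = refl
sumBelow-cong (suc n) f≗g = cong₂ _+_ (f≗g 0) (sumBelow-cong n (λ i → f≗g (suc i)))

sumBelow-last : ∀ n f → sumBelow (suc n) f ≡ sumBelow n f + f n
sumBelow-last zero    f = +-comm (f 0) 0
sumBelow-last (suc n) f =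
  trans (cong (f 0 +_) (sumBelow-last n (λ i → f (suc i)))) (sym (+-assoc (f 0) _ _))

-- Column x sits at 2x + 1 on the doubled axis, where the centre of a grid
-- with a columns is at a.
axis : ℕ → ℕ
axis x = suc (2 * x)

dev : ℕ → ℕ → ℕ
dev a x = ∣ axis x - a ∣

totalDev : ℕ → ℕ
totalDev a = sumBelow a (dev a)

-- Adding a column on each side moves the old columns one step inwards
-- relative to the new centre, and the two new columns deviate by a + 1.
totalDev-step : ∀ a → totalDev (suc (suc a)) ≡ suc a + totalDev a + suc a
totalDev-step a = begin
  totalDev (suc (suc a))                       ≡⟨ cong (suc a +_) (sumBelow-last a inner) ⟩
  suc a + (sumBelow a inner + inner a)         ≡⟨ cong₂ (λ s t → suc a + (s + t))
                                                        (sumBelow-cong a dev-shift) dev-edge ⟩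
  suc a + (totalDev a + suc a)                 ≡⟨ sym (+-assoc (suc a) _ _) ⟩
  suc a + totalDev a + suc a                   ∎
  where
  open ≡-Reasoning
  inner : ℕ → ℕ
  inner i = dev (suc (suc a)) (suc i)
  dev-shift : ∀ i → inner i ≡ dev a i
  dev-shift i = cong (λ z → ∣ z - suc a ∣) (double-suc i)
    where double-suc : ∀ i → 2 * suc i ≡ suc (suc (2 * i))
          double-suc = solve-∀
  dev-edge : inner a ≡ suc a
  dev-edge = begin
    ∣ 2 * suc a - suc a ∣       ≡⟨ cong (λ z → ∣ z - suc a ∣) (double (suc a)) ⟩
    ∣ suc a + suc a - suc a ∣   ≡⟨ ∣-∣-comm (suc a + suc a) (suc a) ⟩
    ∣ suc a - suc a + suc a ∣   ≡⟨ ∣m-m+n∣≡n (suc a) (suc a) ⟩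
    suc a                       ∎
    where double : ∀ n → 2 * n ≡ n + n
          double = solve-∀

totalDev-closed : ∀ m k → totalDev (k + (m + k)) ≡ 2 * k * (k + m) + totalDev m
totalDev-closed m zero    = cong totalDev (+-identityʳ m)
totalDev-closed m (suc k) = begin
  totalDev (suc k + (m + suc k))        ≡⟨ cong totalDev (widen k) ⟩
  totalDev (suc (suc a))                ≡⟨ totalDev-step a ⟩
  suc a + totalDev a + suc a            ≡⟨ cong (λ t → suc a + t + suc a) (totalDev-closed m k) ⟩
  suc a + (2 * k * (k + m) + totalDev m) + suc a ≡⟨ regroup k m (totalDev m) ⟩
  2 * suc k * (suc k + m) + totalDev m  ∎
  where
  open ≡-Reasoning
  a = k + (m + k)
  widen : ∀ k → suc k + (m + suc k) ≡ suc (suc (k + (m + k)))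
  widen k = cong suc (trans (cong (k +_) (+-suc m k)) (+-suc k (m + k)))
  regroup : ∀ k m t → suc (k + (m + k)) + (2 * k * (k + m) + t) + suc (k + (m + k))
                      ≡ 2 * suc k * (suc k + m) + t
  regroup = solve-∀

-- Orderings of the grid

xcoord : ∀ {a b} → Vertex a b → ℕ
xcoord v = toℕ (proj₁ v)

axisOf : ∀ {a b} → Vertex a b → ℕ
axisOf v = axis (xcoord v)

absDiff-∣-∣ : ∀ m n → absDiff m n ≡ ∣ m - n ∣
absDiff-∣-∣ zero    zero    = refl
absDiff-∣-∣ zero    (suc n) = refl
absDiff-∣-∣ (suc m) zero    = +-identityʳ (suc m)
absDiff-∣-∣ (suc m) (suc n) = absDiff-∣-∣ m n

dxList-axis : ∀ {a b} (s : List (Vertex a b)) → variation (map axisOf s) ≡ 2 * dxList s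
dxList-axis []          = refl
dxList-axis (u ∷ [])    = refl
dxList-axis (u ∷ v ∷ s) = begin
  ∣ 2 * xcoord u - 2 * xcoord v ∣ + variation (map axisOf (v ∷ s))
    ≡⟨ cong₂ _+_ (sym (*-distribˡ-∣-∣ 2 (xcoord u) (xcoord v))) (dxList-axis (v ∷ s)) ⟩
  2 * ∣ xcoord u - xcoord v ∣ + 2 * dxList (v ∷ s)
    ≡⟨ cong (λ d → 2 * d + 2 * dxList (v ∷ s)) (sym (absDiff-∣-∣ (xcoord u) (xcoord v))) ⟩
  2 * absDiff (xcoord u) (xcoord v) + 2 * dxList (v ∷ s)
    ≡⟨ sym (*-distribˡ-+ 2 (absDiff (xcoord u) (xcoord v)) (dxList (v ∷ s))) ⟩
  2 * dxList (u ∷ v ∷ s) ∎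
  where open ≡-Reasoning

column : ∀ {a} b → Fin a → List (Vertex a b)
column b x = map (x ,_) (allFin b)

columns-sum : ∀ {a} b (h : ℕ → ℕ) (xs : List (Fin a)) →
  sum (map (h ∘ xcoord) (concatMap (column b) xs)) ≡ b * sum (map (h ∘ toℕ) xs)
columns-sum b h []       = sym (*-zeroʳ b)
columns-sum b h (x ∷ xs) = begin
  sum (map (h ∘ xcoord) (column b x ++ concatMap (column b) xs))
    ≡⟨ cong sum (map-++ (h ∘ xcoord) (column b x) _) ⟩
  sum (map (h ∘ xcoord) (column b x) ++ map (h ∘ xcoord) (concatMap (column b) xs))
    ≡⟨ sum-++ (map (h ∘ xcoord) (column b x)) _ ⟩
  sum (map (h ∘ xcoord) (column b x)) + sum (map (h ∘ xcoord) (concatMap (column b) xs))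
    ≡⟨ cong₂ _+_ (trans (constant-sum (allFin b)) (cong (_* h (toℕ x)) (length-tabulate {n = b} (λ y → y))))
                 (columns-sum b h xs) ⟩
  b * h (toℕ x) + b * sum (map (h ∘ toℕ) xs)
    ≡⟨ sym (*-distribˡ-+ b _ _) ⟩
  b * sum (map (h ∘ toℕ) (x ∷ xs)) ∎
  where
  open ≡-Reasoning
  constant-sum : ∀ ys → sum (map (h ∘ xcoord) (map (x ,_) ys)) ≡ length ys * h (toℕ x)
  constant-sum []       = refl
  constant-sum (y ∷ ys) = cong (h (toℕ x) +_) (constant-sum ys)

allFin-sum : ∀ n (h : ℕ → ℕ) → sum (map (h ∘ toℕ) (allFin n)) ≡ sumBelow n h
allFin-sum n h = trans (cong sum (map-tabulate {n = n} (λ i → i) (h ∘ toℕ))) (tabulate-sum n h)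
  where
  tabulate-sum : ∀ n (h : ℕ → ℕ) → sum (tabulate {n = n} (h ∘ toℕ)) ≡ sumBelow n h
  tabulate-sum zero    h = refl
  tabulate-sum (suc n) h = cong (h 0 +_) (tabulate-sum n (h ∘ suc))

grid-sum : ∀ a b (h : ℕ → ℕ) → sum (map (h ∘ xcoord) (allVertices a b)) ≡ b * sumBelow a h
grid-sum a b h = trans (columns-sum b h (allFin a)) (cong (b *_) (allFin-sum a h))

ordering-spread : ∀ {a b} {s : List (Vertex a b)} → s ↭ allVertices a b →
  spread a (map axisOf s) ≡ b * totalDev a
ordering-spread {a} {b} {s} s↭grid = begin
  spread a (map axisOf s)           ≡⟨ cong sum (sym (map-∘ s)) ⟩
  sum (map (dev a ∘ xcoord) s)      ≡⟨ sum-↭ (↭.map⁺ (dev a ∘ xcoord) s↭grid) ⟩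
  sum (map (dev a ∘ xcoord) (allVertices a b)) ≡⟨ grid-sum a b (dev a) ⟩
  b * totalDev a                    ∎
  where open ≡-Reasoning

to-axis : ∀ {a b} (u : Vertex a b) s →
  2 * dxList (u ∷ s) + dev a (xcoord u) + dev a (xcoord (final u s))
  ≡ variation (map axisOf (u ∷ s)) + ∣ axisOf u - a ∣ + ∣ final (axisOf u) (map axisOf s) - a ∣
to-axis {a} u s = cong₂ (λ d l → d + ∣ axisOf u - a ∣ + ∣ l - a ∣)
                        (sym (dxList-axis (u ∷ s))) (sym (final-map axisOf u s))

ordering-bound : ∀ {a b} (u : Vertex a b) s → (u ∷ s) ↭ allVertices a b →
  2 * dxList (u ∷ s) + dev a (xcoord u) + dev a (xcoord (final u s)) ≤ 2 * (b * totalDev a)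
ordering-bound {a} {b} u s s↭grid = begin
  2 * dxList (u ∷ s) + dev a (xcoord u) + dev a (xcoord (final u s)) ≡⟨ to-axis u s ⟩
  variation (map axisOf (u ∷ s)) + ∣ axisOf u - a ∣ + ∣ final (axisOf u) (map axisOf s) - a ∣
    ≤⟨ variation-bound a (axisOf u) (map axisOf s) ⟩
  2 * spread a (map axisOf (u ∷ s)) ≡⟨ cong (2 *_) (ordering-spread s↭grid) ⟩
  2 * (b * totalDev a) ∎
  where open ≤-Reasoning

ordering-exact : ∀ {a b} (u : Vertex a b) s → (u ∷ s) ↭ allVertices a b →
  Alternates a (map axisOf (u ∷ s)) →
  2 * dxList (u ∷ s) + dev a (xcoord u) + dev a (xcoord (final u s)) ≡ 2 * (b * totalDev a)
ordering-exact {a} {b} u s s↭grid alt = begin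
  2 * dxList (u ∷ s) + dev a (xcoord u) + dev a (xcoord (final u s)) ≡⟨ to-axis u s ⟩
  variation (map axisOf (u ∷ s)) + ∣ axisOf u - a ∣ + ∣ final (axisOf u) (map axisOf s) - a ∣
    ≡⟨ variation-exact a (axisOf u) (map axisOf s) alt ⟩
  2 * spread a (map axisOf (u ∷ s)) ≡⟨ cong (2 *_) (ordering-spread s↭grid) ⟩
  2 * (b * totalDev a) ∎
  where open ≡-Reasoning

dx-bound : ∀ {a b} e → (∀ x → e ≤ dev a x) → (s : Ordering a b) → dx s ≤ b * totalDev a ∸ e
dx-bound e low ([] , _) = z≤n
dx-bound {a} {b} e low (u ∷ s , s↭grid) = begin
  dxList (u ∷ s)         ≡⟨ sym (m+n∸n≡m (dxList (u ∷ s)) e) ⟩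
  dxList (u ∷ s) + e ∸ e ≤⟨ ∸-monoˡ-≤ e (*-cancelˡ-≤ 2 doubled) ⟩
  b * totalDev a ∸ e     ∎
  where
  open ≤-Reasoning
  doubled : 2 * (dxList (u ∷ s) + e) ≤ 2 * (b * totalDev a)
  doubled = begin
    2 * (dxList (u ∷ s) + e)       ≡⟨ double-+ (dxList (u ∷ s)) e ⟩
    2 * dxList (u ∷ s) + e + e
      ≤⟨ +-mono-≤ (+-monoʳ-≤ (2 * dxList (u ∷ s)) (low (xcoord u))) (low (xcoord (final u s))) ⟩
    2 * dxList (u ∷ s) + dev a (xcoord u) + dev a (xcoord (final u s)) ≤⟨ ordering-bound u s s↭grid ⟩
    2 * (b * totalDev a)           ∎
    where double-+ : ∀ d e → 2 * (d + e) ≡ 2 * d + e + e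
          double-+ = solve-∀

dx-exact : ∀ {a b} e (u : Vertex a b) s → (u ∷ s) ↭ allVertices a b →
  Alternates a (map axisOf (u ∷ s)) → dev a (xcoord u) ≡ e → dev a (xcoord (final u s)) ≡ e →
  dxList (u ∷ s) ≡ b * totalDev a ∸ e
dx-exact {a} {b} e u s s↭grid alt first last = begin
  dxList (u ∷ s)         ≡⟨ sym (m+n∸n≡m (dxList (u ∷ s)) e) ⟩
  dxList (u ∷ s) + e ∸ e ≡⟨ cong (_∸ e) (*-cancelˡ-≡ _ _ 2 doubled) ⟩
  b * totalDev a ∸ e     ∎
  where
  open ≡-Reasoning
  doubled : 2 * (dxList (u ∷ s) + e) ≡ 2 * (b * totalDev a)
  doubled = begin
    2 * (dxList (u ∷ s) + e)       ≡⟨ double-+ (dxList (u ∷ s)) e ⟩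
    2 * dxList (u ∷ s) + e + e     ≡⟨ cong₂ (λ f l → 2 * dxList (u ∷ s) + f + l) (sym first) (sym last) ⟩
    2 * dxList (u ∷ s) + dev a (xcoord u) + dev a (xcoord (final u s)) ≡⟨ ordering-exact u s s↭grid alt ⟩
    2 * (b * totalDev a)           ∎
    where double-+ : ∀ d e → 2 * (d + e) ≡ 2 * d + e + e
          double-+ = solve-∀

shape-parity : ∀ m k → (k + (m + k)) % 2 ≡ m % 2
shape-parity m k = trans (cong (_% 2) (as-multiple m k)) ([m+kn]%n≡m%n m k 2)
  where as-multiple : ∀ m k → k + (m + k) ≡ m + k * 2
        as-multiple = solve-∀

even-dev-positive : ∀ {a} → a % 2 ≡ 0 → ∀ x → 1 ≤ dev a x
even-dev-positive {a} a-even x = n≢0⇒n>0 (λ central → 0≢1+n (begin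
  0              ≡⟨ sym a-even ⟩
  a % 2          ≡⟨ cong (_% 2) (sym (∣m-n∣≡0⇒m≡n {axis x} {a} central)) ⟩
  axis x % 2     ≡⟨ cong (_% 2) (+-comm 1 (2 * x)) ⟩
  (2 * x + 1) % 2 ≡⟨ cong (λ y → (y + 1) % 2) (*-comm 2 x) ⟩
  (x * 2 + 1) % 2 ≡⟨ cong (_% 2) (+-comm (x * 2) 1) ⟩
  (1 + x * 2) % 2 ≡⟨ [m+kn]%n≡m%n 1 x 2 ⟩
  1              ∎))
  where open ≡-Reasoning

maxDx-when-odd : ∀ a b → a % 2 ≡ 1 → maxDx a b ≡ ((a * a ∸ 1) * b) / 2
maxDx-when-odd a b a-odd with a % 2 | a-odd
... | _ | refl = refl

maxDx-when-even : ∀ a b → a % 2 ≡ 0 → maxDx a b ≡ (a * a * b) / 2 ∸ 1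
maxDx-when-even a b a-even with a % 2 | a-even
... | _ | refl = refl

maxDx-odd : ∀ k b → maxDx (k + suc k) b ≡ b * totalDev (k + suc k)
maxDx-odd k b = begin
  maxDx (k + suc k) b                        ≡⟨ maxDx-when-odd (k + suc k) b (shape-parity 1 k) ⟩
  (((k + suc k) * (k + suc k) ∸ 1) * b) / 2  ≡⟨ cong (λ n → ((n ∸ 1) * b) / 2) (square k) ⟩
  ((4 * k * suc k) * b) / 2                  ≡⟨ cong (_/ 2) (halves k b) ⟩
  (b * (2 * k * (k + 1) + 0)) * 2 / 2        ≡⟨ m*n/n≡m (b * (2 * k * (k + 1) + 0)) 2 ⟩
  b * (2 * k * (k + 1) + 0)                  ≡⟨ cong (b *_) (sym (totalDev-closed 1 k)) ⟩
  b * totalDev (k + suc k)                   ∎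
  where
  open ≡-Reasoning
  square : ∀ k → (k + suc k) * (k + suc k) ≡ suc (4 * k * suc k)
  square = solve-∀
  halves : ∀ k b → (4 * k * suc k) * b ≡ (b * (2 * k * (k + 1) + 0)) * 2
  halves = solve-∀

maxDx-even : ∀ k b → maxDx (k + suc (suc k)) b ≡ b * totalDev (k + suc (suc k)) ∸ 1
maxDx-even k b = begin
  maxDx (k + suc (suc k)) b                          ≡⟨ maxDx-when-even (k + suc (suc k)) b (shape-parity 2 k) ⟩
  ((k + suc (suc k)) * (k + suc (suc k)) * b) / 2 ∸ 1 ≡⟨ cong (λ n → n / 2 ∸ 1) (halves k b) ⟩
  (b * (2 * k * (k + 2) + 2)) * 2 / 2 ∸ 1            ≡⟨ cong (_∸ 1) (m*n/n≡m (b * (2 * k * (k + 2) + 2)) 2) ⟩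
  b * (2 * k * (k + 2) + 2) ∸ 1                      ≡⟨ cong (λ t → b * t ∸ 1) (sym (totalDev-closed 2 k)) ⟩
  b * totalDev (k + suc (suc k)) ∸ 1                 ∎
  where
  open ≡-Reasoning
  halves : ∀ k b → (k + suc (suc k)) * (k + suc (suc k)) * b ≡ (b * (2 * k * (k + 2) + 2)) * 2
  halves = solve-∀

-- Zig-zag orderings

interleave : List A → List A → List A
interleave []       ys       = ys
interleave (x ∷ xs) []       = x ∷ xs
interleave (x ∷ xs) (y ∷ ys) = x ∷ y ∷ interleave xs ys

interleave-↭ : (xs ys : List A) → interleave xs ys ↭ xs ++ ys
interleave-↭ []       ys       = ↭-refl
interleave-↭ (x ∷ xs) []       = ↭-sym (↭.++-identityʳ (x ∷ xs))
interleave-↭ (x ∷ xs) (y ∷ ys) = prep x (↭-trans (prep y (interleave-↭ xs ys)) (↭-sym (↭.shift y xs ys)))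

map-interleave : (f : A → B) (xs ys : List A) → map f (interleave xs ys) ≡ interleave (map f xs) (map f ys)
map-interleave f []       ys       = refl
map-interleave f (x ∷ xs) []       = refl
map-interleave f (x ∷ xs) (y ∷ ys) = cong (λ zs → f x ∷ f y ∷ zs) (map-interleave f xs ys)

interleave-alternates : ∀ {c} p xs ys zs → c ≤ p → All (_≤ c) xs → All (c ≤_) ys →
  length xs ≡ length ys → (∀ w → c ≤ w → Alternates c (w ∷ zs)) →
  Alternates c (p ∷ interleave xs ys ++ zs)
interleave-alternates p []       []       zs c≤p []           []           _   tail = tail p c≤p
interleave-alternates p (x ∷ xs) (y ∷ ys) zs c≤p (x≤c ∷ x≤cs) (c≤y ∷ c≤ys) len tail =
  inj₂ (c≤p , x≤c) , inj₁ (x≤c , c≤y) ,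
  interleave-alternates y xs ys zs c≤y x≤cs c≤ys (suc-injective len) tail

central-alternates : ∀ {c} w zs → All (_≡ c) zs → Alternates c (w ∷ zs)
central-alternates {c} w []       []           = tt
central-alternates {c} w (z ∷ zs) (refl ∷ z≡c) = straddle w , central-alternates z zs z≡c
  where straddle : ∀ w → Straddle c w c
        straddle w with ≤-total w c
        ... | inj₁ w≤c = inj₁ (w≤c , ≤-refl)
        ... | inj₂ c≤w = inj₂ (c≤w , ≤-refl)

-- The data of a zig-zag ordering  start, L₁, H₁, L₂, H₂, ..., Lₙ, Hₙ, rest  of the
-- grid that starts right of the centre, alternates between the left part L and
-- the right part H, and whose ends deviate by e from the centre.
record Zigzag (a b e : ℕ) : Set where
  field
    start             : Vertex a b
    lefts rights rest : List (Vertex a b)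
    covers            : start ∷ lefts ++ rights ++ rest ↭ allVertices a b
    start-right       : a ≤ axisOf start
    lefts-left        : All (λ v → axisOf v ≤ a) lefts
    rights-right      : All (λ v → a ≤ axisOf v) rights
    balanced          : length lefts ≡ length rights
    rest-alternates   : ∀ w → a ≤ w → Alternates a (w ∷ map axisOf rest)
    start-dev         : dev a (xcoord start) ≡ e
    end-dev           : dev a (xcoord (final start (interleave lefts rights ++ rest))) ≡ e

zigzag-attains : ∀ {a b e} → Zigzag a b e → Σ (Ordering a b) (λ s → dx s ≡ b * totalDev a ∸ e)
zigzag-attains {a} {b} {e} z = (start ∷ path , ordering) ,
  dx-exact e start path ordering alternates start-dev end-dev
  where
  open Zigzag z
  path : List (Vertex a b)
  path = interleave lefts rights ++ rest
  ordering : start ∷ path ↭ allVertices a b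
  ordering = ↭-trans (prep start (↭-trans (↭.++⁺ʳ rest (interleave-↭ lefts rights))
                                              (↭.++-assoc lefts rights rest)))
                       covers
  axis-path : map axisOf path ≡ interleave (map axisOf lefts) (map axisOf rights) ++ map axisOf rest
  axis-path = trans (map-++ axisOf (interleave lefts rights) rest)
                    (cong (_++ map axisOf rest) (map-interleave axisOf lefts rights))
  alternates : Alternates a (map axisOf (start ∷ path))
  alternates = subst (λ zs → Alternates a (axisOf start ∷ zs)) (sym axis-path)
    (interleave-alternates (axisOf start) _ _ _ start-right (All.map⁺ lefts-left) (All.map⁺ rights-right)
       (trans (length-map axisOf lefts) (trans balanced (sym (length-map axisOf rights))))
       rest-alternates)

tabulate-+ : ∀ m n (g : Fin (m + n) → A) →
  tabulate g ≡ tabulate (λ i → g (i ↑ˡ n)) ++ tabulate (λ j → g (m ↑ʳ j))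
tabulate-+ zero    n g = refl
tabulate-+ (suc m) n g = cong (g Fin.zero ∷_) (tabulate-+ m n (λ i → g (Fin.suc i)))

along-column : ∀ {a b} (Q : ℕ → Set) {x : Fin a} → Q (toℕ x) →
  (ys : List (Fin b)) → All (Q ∘ xcoord) (map (x ,_) ys)
along-column Q q ys = All.map⁺ (All.universal (λ _ → q) ys)

along-columns : ∀ {a} b (Q : ℕ → Set) {xs : List (Fin a)} → All (Q ∘ toℕ) xs →
  All (Q ∘ xcoord) (concatMap (column b) xs)
along-columns b Q []       = []
along-columns b Q (q ∷ qs) = All.++⁺ (along-column Q q (allFin b)) (along-columns b Q qs)

columns-length : ∀ {a} b (xs : List (Fin a)) → length (concatMap (column b) xs) ≡ length xs * b
columns-length b []       = refl
columns-length b (x ∷ xs) = trans (length-++ (column b x))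
  (cong₂ _+_ (trans (length-map _ (allFin b)) (length-tabulate {n = b} (λ y → y))) (columns-length b xs))

left-of-centre : ∀ k m {x} → x < k → axis x ≤ k + (m + k)
left-of-centre k m {x} x<k = begin
  axis x        ≡⟨ as-sum x ⟩
  suc x + x     ≤⟨ +-mono-≤ x<k (<⇒≤ x<k) ⟩
  k + k         ≤⟨ +-monoʳ-≤ k (m≤n+m k m) ⟩
  k + (m + k)   ∎
  where
  open ≤-Reasoning
  as-sum : ∀ x → suc (2 * x) ≡ suc x + x
  as-sum = solve-∀

right-of-centre : ∀ k m j → k + (m + k) ≤ axis (k + (m + j))
right-of-centre k m j = ≤-trans (m≤m+n (k + (m + k)) (suc (m + 2 * j))) (≤-reflexive (excess k m j))
  where excess : ∀ k m j → k + (m + k) + suc (m + 2 * j) ≡ suc (2 * (k + (m + j)))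
        excess = solve-∀

module Split (k m b : ℕ) where

  a : ℕ
  a = k + (m + k)

  leftCols centralCols rightCols : List (Fin a)
  leftCols    = tabulate {n = k} (λ i → i ↑ˡ (m + k))
  centralCols = tabulate {n = m} (λ j → k ↑ʳ (j ↑ˡ k))
  rightCols   = tabulate {n = k} (λ j → k ↑ʳ (m ↑ʳ j))

  lefts centrals rights : List (Vertex a b)
  lefts    = concatMap (column b) leftCols
  centrals = concatMap (column b) centralCols
  rights   = concatMap (column b) rightCols

  grid-split : allVertices a b ≡ lefts ++ centrals ++ rights
  grid-split = begin
    concatMap (column b) (allFin a)
      ≡⟨ cong (concatMap (column b)) (tabulate-+ k (m + k) (λ i → i)) ⟩
    concatMap (column b) (leftCols ++ tabulate (k ↑ʳ_))
      ≡⟨ cong (λ cs → concatMap (column b) (leftCols ++ cs)) (tabulate-+ m k (k ↑ʳ_)) ⟩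
    concatMap (column b) (leftCols ++ centralCols ++ rightCols)
      ≡⟨ concatMap-++ (column b) leftCols _ ⟩
    lefts ++ concatMap (column b) (centralCols ++ rightCols)
      ≡⟨ cong (lefts ++_) (concatMap-++ (column b) centralCols rightCols) ⟩
    lefts ++ centrals ++ rights ∎
    where open ≡-Reasoning

  lefts-left : All (λ v → axisOf v ≤ a) lefts
  lefts-left = along-columns b (λ x → axis x ≤ a) (All.tabulate⁺ {n = k} λ i →
    subst (λ x → axis x ≤ a) (sym (toℕ-↑ˡ i (m + k))) (left-of-centre k m (toℕ<n i)))

  rights-right : All (λ v → a ≤ axisOf v) rights
  rights-right = along-columns b (λ x → a ≤ axis x) (All.tabulate⁺ {n = k} λ j →
    subst (λ x → a ≤ axis x) (sym (trans (toℕ-↑ʳ k (m ↑ʳ j)) (cong (k +_) (toℕ-↑ʳ m j))))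
          (right-of-centre k m (toℕ j)))

  balanced : length lefts ≡ length rights
  balanced = begin
    length lefts        ≡⟨ columns-length b leftCols ⟩
    length leftCols * b ≡⟨ cong (_* b) (trans (length-tabulate {n = k} (λ i → i ↑ˡ (m + k)))
                                              (sym (length-tabulate {n = k} (λ j → k ↑ʳ (m ↑ʳ j))))) ⟩
    length rightCols * b ≡⟨ sym (columns-length b rightCols) ⟩
    length rights       ∎
    where open ≡-Reasoning

-- a = 2k + 1, b ≥ 2: start at the bottom of the central column, zig-zag through
-- the left and right parts, and finish with the rest of the central column.
-- Both ends are central, so dx = b D(a).
odd-zigzag : ∀ k b' → Zigzag (k + suc k) (suc (suc b')) 0
odd-zigzag k b' = record
  { start           = bottom
  ; lefts           = lefts
  ; rights          = rights
  ; rest            = crest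
  ; covers          = covers
  ; start-right     = ≤-reflexive (sym centre-axis)
  ; lefts-left      = lefts-left
  ; rights-right    = rights-right
  ; balanced        = balanced
  ; rest-alternates = λ w _ → central-alternates w (map axisOf crest)
                        (All.map⁺ (along-column (λ x → axis x ≡ a) {centre} centre-axis (tabulate Fin.suc)))
  ; start-dev       = centre-dev
  ; end-dev         = trans (cong (dev a ∘ xcoord) end) centre-dev
  }
  where
  open Split k 1 (suc (suc b'))
  centre : Fin a
  centre = k ↑ʳ Fin.zero
  bottom : Vertex a (suc (suc b'))
  bottom = (centre , Fin.zero)
  crest : List (Vertex a (suc (suc b')))
  crest = map (centre ,_) (tabulate Fin.suc)

  centre-axis : axis (toℕ centre) ≡ a
  centre-axis = trans (cong axis (toℕ-↑ʳ k (Fin.zero {n = k}))) (doubling k)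
    where doubling : ∀ k → suc (2 * (k + 0)) ≡ k + suc k
          doubling = solve-∀

  centre-dev : dev a (toℕ centre) ≡ 0
  centre-dev = m≡n⇒∣m-n∣≡0 centre-axis

  above : List (Fin (suc (suc b')))
  above = tabulate (λ y → Fin.suc (Fin.suc y))

  end : final bottom (interleave lefts rights ++ crest) ≡ (centre , final (Fin.suc Fin.zero) above)
  end = trans (final-++ bottom (interleave lefts rights) _ _) (final-map (centre ,_) (Fin.suc Fin.zero) above)

  covers : bottom ∷ lefts ++ rights ++ crest ↭ allVertices a (suc (suc b'))
  covers = ↭-trans
    (prove 4 (Bot ⊕ (Lft ⊕ (Rgt ⊕ Crs))) (Lft ⊕ ((Bot ⊕ Crs) ⊕ id) ⊕ Rgt)
             ((bottom ∷ []) ∷ lefts ∷ rights ∷ crest ∷ []))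
    (↭-reflexive (sym grid-split))
    where
    open CommutativeMonoidSolver ↭.++-commutativeMonoid
    Bot Lft Rgt Crs : Expr 4
    Bot = var (# 0)
    Lft = var (# 1)
    Rgt = var (# 2)
    Crs = var (# 3)

∣n-1+n∣≡1 : ∀ n → ∣ n - suc n ∣ ≡ 1
∣n-1+n∣≡1 zero    = refl
∣n-1+n∣≡1 (suc n) = ∣n-1+n∣≡1 n

-- a = 2k + 2, b ≥ 1: the two central columns lie at a - 1 and a + 1 on the
-- doubled axis.  Start at the bottom of the right central column, zig-zag
-- between the left part extended by the rest of the left central column and
-- the right part extended by the rest of the right central column, and finish
-- at the bottom of the left central column.
even-zigzag : ∀ k b' → Zigzag (k + suc (suc k)) (suc b') 1
even-zigzag k b' = record
  { start           = (right , Fin.zero)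
  ; lefts           = lefts ++ upper left
  ; rights          = upper right ++ rights
  ; rest            = finish ∷ []
  ; covers          = covers
  ; start-right     = ≤-trans (n≤1+n a) (≤-reflexive (sym right-axis))
  ; lefts-left      = All.++⁺ lefts-left (along-column (λ x → axis x ≤ a) {left} left-below (tabulate Fin.suc))
  ; rights-right    = All.++⁺ (along-column (λ x → a ≤ axis x) {right} right-above (tabulate Fin.suc)) rights-right
  ; balanced        = extended-balanced
  ; rest-alternates = λ w a≤w → inj₂ (a≤w , left-below) , tt
  ; start-dev       = trans (cong (λ y → ∣ y - a ∣) right-axis) (trans (∣-∣-comm (suc a) a) (∣n-1+n∣≡1 a))
  ; end-dev         = trans (cong (dev a ∘ xcoord) (final-++ (right , Fin.zero) (interleave (lefts ++ upper left) (upper right ++ rights)) finish []))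
                            (trans (cong (λ y → ∣ axis (toℕ left) - y ∣) (sym left-axis))
                                   (∣n-1+n∣≡1 (axis (toℕ left))))
  }
  where
  open Split k 2 (suc b')
  left right : Fin a
  left  = k ↑ʳ Fin.zero
  right = k ↑ʳ Fin.suc Fin.zero

  upper : Fin a → List (Vertex a (suc b'))
  upper x = map (x ,_) (tabulate {n = b'} Fin.suc)

  finish : Vertex a (suc b')
  finish = (left , Fin.zero)

  left-axis : suc (axis (toℕ left)) ≡ a
  left-axis = trans (cong (suc ∘ axis) (toℕ-↑ʳ k (Fin.zero {n = suc k}))) (doubling k)
    where doubling : ∀ k → suc (suc (2 * (k + 0))) ≡ k + suc (suc k)
          doubling = solve-∀

  right-axis : axis (toℕ right) ≡ suc a
  right-axis = trans (cong axis (toℕ-↑ʳ k (Fin.suc (Fin.zero {n = k})))) (doubling k)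
    where doubling : ∀ k → suc (2 * (k + 1)) ≡ suc (k + suc (suc k))
          doubling = solve-∀

  left-below : axis (toℕ left) ≤ a
  left-below = subst (axis (toℕ left) ≤_) left-axis (n≤1+n _)

  right-above : a ≤ axis (toℕ right)
  right-above = subst (a ≤_) (sym right-axis) (n≤1+n a)

  upper-length : ∀ x → length (upper x) ≡ b'
  upper-length x = trans (length-map (x ,_) (tabulate {n = b'} Fin.suc)) (length-tabulate {n = b'} Fin.suc)

  extended-balanced : length (lefts ++ upper left) ≡ length (upper right ++ rights)
  extended-balanced = begin
    length (lefts ++ upper left)           ≡⟨ length-++ lefts ⟩
    length lefts + length (upper left)     ≡⟨ cong₂ _+_ balanced (upper-length left) ⟩
    length rights + b'                     ≡⟨ +-comm (length rights) b' ⟩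
    b' + length rights                     ≡⟨ cong (_+ length rights) (sym (upper-length right)) ⟩
    length (upper right) + length rights   ≡⟨ sym (length-++ (upper right)) ⟩
    length (upper right ++ rights)         ∎
    where open ≡-Reasoning

  covers : (right , Fin.zero) ∷ (lefts ++ upper left) ++ (upper right ++ rights) ++ finish ∷ []
           ↭ allVertices a (suc b')
  covers = ↭-trans
    (prove 6 (Str ⊕ ((Lft ⊕ Lup) ⊕ ((Rup ⊕ Rgt) ⊕ (End ⊕ id))))
             (Lft ⊕ ((End ⊕ Lup) ⊕ ((Str ⊕ Rup) ⊕ id)) ⊕ Rgt)
             (((right , Fin.zero) ∷ []) ∷ lefts ∷ upper left ∷ upper right ∷ rights ∷ (finish ∷ []) ∷ []))
    (↭-reflexive (sym grid-split))
    where
    open CommutativeMonoidSolver ↭.++-commutativeMonoid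
    Str Lft Lup Rup Rgt End : Expr 6
    Str = var (# 0)
    Lft = var (# 1)
    Lup = var (# 2)
    Rup = var (# 3)
    Rgt = var (# 4)
    End = var (# 5)

odd-or-even : ∀ n → (∃[ k ] suc n ≡ k + suc k) ⊎ (∃[ k ] suc n ≡ k + suc (suc k))
odd-or-even zero    = inj₁ (0 , refl)
odd-or-even (suc n) with odd-or-even n
... | inj₁ (k , odd)  = inj₂ (k , trans (cong suc odd) (sym (+-suc k (suc k))))
... | inj₂ (k , even) = inj₁ (suc k , cong suc even)

IsMaximum : ℕ → ℕ → Set
IsMaximum a b = Σ (Ordering a b) (λ s → dx s ≡ maxDx a b) × ((s : Ordering a b) → dx s ≤ maxDx a b)

maximum-by-zigzag : ∀ {a b} e → maxDx a b ≡ b * totalDev a ∸ e → (∀ x → e ≤ dev a x) →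
  Zigzag a b e → IsMaximum a b
maximum-by-zigzag e value floor zigzag with zigzag-attains zigzag
... | s , s-dx = (s , trans s-dx (sym value)) , λ t → subst (dx t ≤_) (sym value) (dx-bound e floor t)

lemma3p2 : (a b : ℕ) → a > 2 → b > 2 →
    Σ (Ordering a b) (λ s → dx s ≡ maxDx a b) × ((s : Ordering a b) → dx s ≤ maxDx a b)
lemma3p2 (suc n) b@(suc (suc (suc b''))) _ (s≤s (s≤s (s≤s _))) with odd-or-even n
... | inj₁ (k , odd)  = subst (λ a → IsMaximum a b) (sym odd)
  (maximum-by-zigzag 0 (maxDx-odd k b) (λ _ → z≤n) (odd-zigzag k (suc b'')))
... | inj₂ (k , even) = subst (λ a → IsMaximum a b) (sym even)
  (maximum-by-zigzag 1 (maxDx-even k b) (even-dev-positive {k + suc (suc k)} (shape-parity 2 k)) (even-zigzag k (suc (suc b''))))
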